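{- If $\Gamma\vdash M:A\mid\Delta$ is derivable in the simply typed $\lambda\mu$-calculus, then $\Gamma^D\vdash M:A^D\mid\Delta^C$ is derivable in the intersection type system, where $\Gamma^D=\{x{:}A^D \mid x{:}A\in\Gamma\}$ and $\Delta^C=\{\alpha{:}A^C\mid\alpha{:}A\in\Delta\}$.
   Context: Pure $\lambda\mu$-calculus: terms $M,N ::= x \mid \lambda x.M \mid MN \mid \mu\alpha.C$, commands $C ::= [\alpha]M$, over disjoint denumerable sets of term variables and names; $\lambda$ binds $x$, $\mu$ binds $\alpha$; bound and free variables/names are kept distinct. Simply typed $\lambda\mu$-calculus: formulas $A,B ::= \varphi \mid A\to B$ ($\varphi$ ranging over proposition variables); $\Gamma$ assigns formulas to term variables, $\Delta$ assigns formulas to names; rules: $\Gamma,x{:}A\vdash x:A\mid\Delta$; from $\Gamma,x{:}A\vdash M:B\mid\Delta$ infer $\Gamma\vdash\lambda x.M:A\to B\mid\Delta$; from $\Gamma\vdash M:A\to B\mid\Delta$ and $\Gamma\vdash N:A\mid\Delta$ infer $\Gamma\vdash MN:B\mid\Delta$; from $\Gamma\vdash M:A\mid\alpha{:}A,\Delta$ infer $\Gamma\vdash\mu\alpha.[\alpha]M:A\mid\Delta$; from $\Gamma\vdash M:B\mid\alpha{:}A,\beta{:}B,\Delta$ infer $\Gamma\vdash\mu\alpha.[\beta]M:A\mid\beta{:}B,\Delta$. Intersection type system: with a single constant $\nu$ and a symbol $\omega$ (not itself a type), term types $\delta ::= \nu \mid \omega\to\nu \mid \kappa\to\nu \mid \delta\wedge\delta$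 and stack types $\kappa ::= \delta\times\omega \mid \delta\times\kappa \mid \kappa\wedge\kappa$. The preorder $\le$ is the least preorder with: $\sigma\wedge\tau\le\sigma$; $\sigma\wedge\tau\le\tau$; $\nu\le\omega\to\nu$; $\omega\to\nu\le\nu$; $\delta_1\times\delta_2\times\omega\le\delta_1\times\omega$; $(\delta_1\times\omega)\wedge(\delta_2\times\kappa)\le(\delta_1\wedge\delta_2)\times\kappa$; $(\delta_1\times\kappa_1)\wedge(\delta_2\times\kappa_2)\le(\delta_1\wedge\delta_2)\times(\kappa_1\wedge\kappa_2)$; $\delta_1\le\delta_2\Rightarrow\delta_1\times\omega\le\delta_2\times\omega$; $\delta_1\le\delta_2,\kappa_1\le\kappa_2\Rightarrow\delta_1\times\kappa_1\le\delta_2\times\kappa_2$; $\sigma\le\tau_1,\sigma\le\tau_2\Rightarrow\sigma\le\tau_1\wedge\tau_2$; $\kappa_2\le\kappa_1\Rightarrow\kappa_1\to\nu\le\kappa_2\to\nu$. Bases map variables to term types, name contexts map names to stack types. Rules: (ax) $\Gamma,x{:}\delta\vdash x:\delta\mid\Delta$; (abs) from $\Gamma,x{:}\delta\vdash M:\kappa\to\nu\mid\Delta$ infer $\Gamma\vdash\lambda x.M:\delta\times\kappa\to\nu\mid\Delta$; (app) from $\Gamma\vdash M:\delta\times\kappa\to\nu\mid\Delta$ and $\Gamma\vdash N:\delta\mid\Delta$ infer $\Gamma\vdash MN:\kappa\to\nu\mid\Delta$ ($\kappa$ a stack type or $\omega$ in (abs), (app)); ($\mu$) from $\Gamma\vdash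 M:\kappa\to\nu\mid\alpha{:}\kappa,\Delta$ infer $\Gamma\vdash\mu\alpha.[\alpha]M:\kappa\to\nu\mid\Delta$, and for $\alpha\ne\beta$ from $\Gamma\vdash M:\kappa'\to\nu\mid\alpha{:}\kappa,\beta{:}\kappa',\Delta$ infer $\Gamma\vdash\mu\alpha.[\beta]M:\kappa\to\nu\mid\beta{:}\kappa',\Delta$; ($\le$) subsumption along $\le$; ($\wedge$) from types $\delta$ and $\delta'$ for $M$ infer $\delta\wedge\delta'$. Translation: $\varphi^C=\nu\times\omega$, $(A\to B)^C=(A^C\to\nu)\times B^C$, and $A^D=A^C\to\nu$. -}

module Defs where

open import Data.Nat using (ℕ; _≟_)
open import Data.Maybe using (Maybe; just; nothing) renaming (map to mapᴹ)
open import Relation.Nullary using (yes; no; ¬_)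
open import Relation.Binary.PropositionalEquality using (_≡_)

Var : Set
Var = ℕ

Name : Set
Name = ℕ

mutual
  data Term : Set where
    var : Var → Term
    lam : Var → Term → Term
    app : Term → Term → Term
    mu  : Name → Command → Term

  data Command : Set where
    [_]_ : Name → Term → Command

Ctx : Set → Set
Ctx A = ℕ → Maybe A

_,_∶_ : {A : Set} → Ctx A → ℕ → A → Ctx A
(Γ , x ∶ a) y with y ≟ x
... | yes _ = just a
... | no  _ = Γ y

data Formula : Set where
  pv  : ℕ → Formula
  _⟶_ : Formula → Formula → Formula

infixr 5 _⟶_

data _⊢s_∶_∣_ : Ctx Formula → Term → Formula → Ctx Formula → Set where
  s-ax  : ∀ {Γ Δ x A} → Γ x ≡ just A → Γ ⊢s var x ∶ A ∣ Δ
  s-abs : ∀ {Γ Δ x M A B} → (Γ , x ∶ A) ⊢s M ∶ B ∣ Δ →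
          Γ ⊢s lam x M ∶ (A ⟶ B) ∣ Δ
  s-app : ∀ {Γ Δ M N A B} → Γ ⊢s M ∶ (A ⟶ B) ∣ Δ → Γ ⊢s N ∶ A ∣ Δ →
          Γ ⊢s app M N ∶ B ∣ Δ
  s-mu₁ : ∀ {Γ Δ α M A} → Γ ⊢s M ∶ A ∣ (Δ , α ∶ A) →
          Γ ⊢s mu α ([ α ] M) ∶ A ∣ Δ
  s-mu₂ : ∀ {Γ Δ α β M A B} → ¬ (α ≡ β) → Δ β ≡ just B →
          Γ ⊢s M ∶ B ∣ (Δ , α ∶ A) →
          Γ ⊢s mu α ([ β ] M) ∶ A ∣ Δ

-- Intersection types.
--   term types  δ ::= ν | ω→ν | κ→ν | δ∧δ
--   stack types κ ::= δ×ω | δ×κ | κ∧κ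
-- 'Tail' is "a stack type or ω".

mutual
  data Ty : Set where
    ν    : Ty
    _⇒ν  : Tail → Ty
    _∧_  : Ty → Ty → Ty

  data Stk : Set where
    _×_  : Ty → Tail → Stk
    _∧ˢ_ : Stk → Stk → Stk

  data Tail : Set where
    ω   : Tail
    stk : Stk → Tail

infixr 6 _×_

mutual
  data _≤ᵗ_ : Ty → Ty → Set where
    ≤ᵗ-refl  : ∀ {δ} → δ ≤ᵗ δ
    ≤ᵗ-trans : ∀ {δ₁ δ₂ δ₃} → δ₁ ≤ᵗ δ₂ → δ₂ ≤ᵗ δ₃ → δ₁ ≤ᵗ δ₃
    ∧ᵗ-lb₁   : ∀ {σ τ} → (σ ∧ τ) ≤ᵗ σ
    ∧ᵗ-lb₂   : ∀ {σ τ} → (σ ∧ τ) ≤ᵗ τ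
    ν≤ων     : ν ≤ᵗ (ω ⇒ν)
    ων≤ν     : (ω ⇒ν) ≤ᵗ ν
    ∧ᵗ-glb   : ∀ {σ τ₁ τ₂} → σ ≤ᵗ τ₁ → σ ≤ᵗ τ₂ → σ ≤ᵗ (τ₁ ∧ τ₂)
    ⇒ν-contra : ∀ {κ₁ κ₂} → κ₂ ≤ˢ κ₁ → (stk κ₁ ⇒ν) ≤ᵗ (stk κ₂ ⇒ν)

  data _≤ˢ_ : Stk → Stk → Set where
    ≤ˢ-refl  : ∀ {κ} → κ ≤ˢ κ
    ≤ˢ-trans : ∀ {κ₁ κ₂ κ₃} → κ₁ ≤ˢ κ₂ → κ₂ ≤ˢ κ₃ → κ₁ ≤ˢ κ₃
    ∧ˢ-lb₁   : ∀ {σ τ} → (σ ∧ˢ τ) ≤ˢ σ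
    ∧ˢ-lb₂   : ∀ {σ τ} → (σ ∧ˢ τ) ≤ˢ τ
    ∧ˢ-glb   : ∀ {σ τ₁ τ₂} → σ ≤ˢ τ₁ → σ ≤ˢ τ₂ → σ ≤ˢ (τ₁ ∧ˢ τ₂)
    ××ω≤×ω   : ∀ {δ₁ δ₂} → (δ₁ × stk (δ₂ × ω)) ≤ˢ (δ₁ × ω)
    dist-ω   : ∀ {δ₁ δ₂ κ} →
               ((δ₁ × ω) ∧ˢ (δ₂ × stk κ)) ≤ˢ ((δ₁ ∧ δ₂) × stk κ)
    dist-κ   : ∀ {δ₁ δ₂ κ₁ κ₂} →
               ((δ₁ × stk κ₁) ∧ˢ (δ₂ × stk κ₂)) ≤ˢ ((δ₁ ∧ δ₂) × stk (κ₁ ∧ˢ κ₂))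
    ×ω-mono  : ∀ {δ₁ δ₂} → δ₁ ≤ᵗ δ₂ → (δ₁ × ω) ≤ˢ (δ₂ × ω)
    ×κ-mono  : ∀ {δ₁ δ₂ κ₁ κ₂} → δ₁ ≤ᵗ δ₂ → κ₁ ≤ˢ κ₂ →
               (δ₁ × stk κ₁) ≤ˢ (δ₂ × stk κ₂)

data _⊢∩_∶_∣_ : Ctx Ty → Term → Ty → Ctx Stk → Set where
  i-ax  : ∀ {Γ Δ x δ} → Γ x ≡ just δ → Γ ⊢∩ var x ∶ δ ∣ Δ
  i-abs : ∀ {Γ Δ x M δ} {κ : Tail} → (Γ , x ∶ δ) ⊢∩ M ∶ (κ ⇒ν) ∣ Δ →
          Γ ⊢∩ lam x M ∶ (stk (δ × κ) ⇒ν) ∣ Δ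
  i-app : ∀ {Γ Δ M N δ} {κ : Tail} → Γ ⊢∩ M ∶ (stk (δ × κ) ⇒ν) ∣ Δ →
          Γ ⊢∩ N ∶ δ ∣ Δ → Γ ⊢∩ app M N ∶ (κ ⇒ν) ∣ Δ
  i-mu₁ : ∀ {Γ Δ α M κ} → Γ ⊢∩ M ∶ (stk κ ⇒ν) ∣ (Δ , α ∶ κ) →
          Γ ⊢∩ mu α ([ α ] M) ∶ (stk κ ⇒ν) ∣ Δ
  i-mu₂ : ∀ {Γ Δ α β M κ κ'} → ¬ (α ≡ β) → Δ β ≡ just κ' →
          Γ ⊢∩ M ∶ (stk κ' ⇒ν) ∣ (Δ , α ∶ κ) →
          Γ ⊢∩ mu α ([ β ] M) ∶ (stk κ ⇒ν) ∣ Δ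
  i-≤   : ∀ {Γ Δ M δ δ'} → Γ ⊢∩ M ∶ δ ∣ Δ → δ ≤ᵗ δ' → Γ ⊢∩ M ∶ δ' ∣ Δ
  i-∧   : ∀ {Γ Δ M δ δ'} → Γ ⊢∩ M ∶ δ ∣ Δ → Γ ⊢∩ M ∶ δ' ∣ Δ →
          Γ ⊢∩ M ∶ (δ ∧ δ') ∣ Δ

_ᶜ : Formula → Stk
pv _ ᶜ = ν × ω
(A ⟶ B) ᶜ = ((stk (A ᶜ)) ⇒ν) × stk (B ᶜ)

_ᴰ : Formula → Ty
A ᴰ = stk (A ᶜ) ⇒ν

ctxᴰ : Ctx Formula → Ctx Ty
ctxᴰ Γ x = mapᴹ _ᴰ (Γ x)

ctxᶜ : Ctx Formula → Ctx Stk
ctxᶜ Δ α = mapᴹ _ᶜ (Δ α)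

-- The translation is compositional: each rule of the simple type system is
-- mapped to the rule of the same name in the intersection type system, since
-- (A ⟶ B)ᴰ = stk (Aᴰ × stk Bᶜ) ⇒ν is exactly the shape that (abs) produces and
-- (app) consumes, and Aᴰ = stk Aᶜ ⇒ν is the shape the (μ) rules relate to Aᶜ.

module Submission where

open import Defs
open import Data.Nat using (_≟_)
open import Data.Maybe using () renaming (map to mapᴹ)
open import Function using (_∘_)
open import Relation.Nullary using (yes; no)
open import Relation.Binary.PropositionalEquality using (_≡_; refl; trans; cong; _≗_)

extend-≗-map : ∀ {A B : Set} (f : A → B) {Γ : Ctx A} {Γ' : Ctx B} x a →
               Γ' ≗ mapᴹ f ∘ Γ → (Γ' , x ∶ f a) ≗ mapᴹ f ∘ (Γ , x ∶ a)
extend-≗-map f x a Γ'≗ y with y ≟ x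
... | yes _ = refl
... | no  _ = Γ'≗ y

-- Generalised to contexts only pointwise equal to the translations, because
-- ctxᴰ (Γ , x ∶ A) and ctxᴰ Γ , x ∶ A ᴰ are not definitionally equal.
translate : ∀ {Γ Δ M A} {Γ' : Ctx Ty} {Δ' : Ctx Stk} → Γ ⊢s M ∶ A ∣ Δ →
            Γ' ≗ ctxᴰ Γ → Δ' ≗ ctxᶜ Δ → Γ' ⊢∩ M ∶ (A ᴰ) ∣ Δ'
translate (s-ax {x = x} Γx≡A) Γ'≗ Δ'≗ =
  i-ax (trans (Γ'≗ x) (cong (mapᴹ _ᴰ) Γx≡A))
translate (s-abs {x = x} {A = A} M∶B) Γ'≗ Δ'≗ =
  i-abs (translate M∶B (extend-≗-map _ᴰ x A Γ'≗) Δ'≗)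
translate (s-app M∶A⟶B N∶A) Γ'≗ Δ'≗ =
  i-app (translate M∶A⟶B Γ'≗ Δ'≗) (translate N∶A Γ'≗ Δ'≗)
translate (s-mu₁ {α = α} {A = A} M∶A) Γ'≗ Δ'≗ =
  i-mu₁ (translate M∶A Γ'≗ (extend-≗-map _ᶜ α A Δ'≗))
translate (s-mu₂ {α = α} {β = β} {A = A} α≢β Δβ≡B M∶B) Γ'≗ Δ'≗ =
  i-mu₂ α≢β (trans (Δ'≗ β) (cong (mapᴹ _ᶜ) Δβ≡B))
        (translate M∶B Γ'≗ (extend-≗-map _ᶜ α A Δ'≗))

theorem3p3 : ∀ {Γ Δ M A} → Γ ⊢s M ∶ A ∣ Δ →
             ctxᴰ Γ ⊢∩ M ∶ (A ᴰ) ∣ ctxᶜ Δ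
theorem3p3 M∶A = translate M∶A (λ _ → refl) (λ _ → refl)
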